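{- Let $\mathbf A=(A,\wedge,\vee,\cdot,\backslash,\slash)$ be a unital residuated binar with multiplicative identity $e$, and suppose $e$ has a complement $e'$ in the lattice reduct. If $\mathbf A$ satisfies any one of the identities $$x (y\wedge z) = x y\wedge x z,\quad (x\wedge y) z = x z\wedge y z,\quad (x\wedge y)\backslash z = x\backslash z\vee y\backslash z,\quad x\slash (y\wedge z) = x\slash y\vee x\slash z,$$ then $\mathbf A$ is integral, i.e., $x\le e$ for all $x\in A$ (equivalently $e=\top$).
   Context: A residuated binar is an algebra $\mathbf A=(A,\wedge,\vee,\cdot,\backslash,\slash)$ where $(A,\wedge,\vee)$ is a lattice, $\cdot$ is a binary operation on $A$ (written $xy$), and for all $x,y,z\in A$: $x\cdot y\le z \iff x\le z\slash y \iff y\le x\backslash z$. It is unital if $\cdot$ has an identity element $e$. A complement of $e$ is an element $e'$ with $e\wedge e'=\bot$ and $e\vee e'=\top$, where $\bot,\top$ are the least and greatest elements of the lattice (assumed to exist). Convention: $\cdot$ binds more tightly than $\backslash,\slash$, which bind more tightly than $\wedge,\vee$. -}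

module Defs where

open import Level using (Level; suc)
open import Data.Product using (_×_; Σ)
open import Data.Sum using (_⊎_)
open import Relation.Binary.PropositionalEquality using (_≡_)
open import Algebra.Core using (Op₂)
open import Algebra.Lattice.Structures using (IsLattice)
open import Algebra.Definitions using (Identity)

record UnitalResiduatedBinar (a : Level) : Set (suc a) where
  infixr 6 _∨_
  infixr 7 _∧_
  infixl 8 _·_
  infixr 8 _＼_
  infixl 8 _／_
  infix 4 _≤_
  field
    Carrier    : Set a
    _∨_        : Op₂ Carrier
    _∧_        : Op₂ Carrier
    _·_        : Op₂ Carrier
    _＼_       : Op₂ Carrier
    _／_       : Op₂ Carrier
    e          : Carrier
    isLattice  : IsLattice _≡_ _∨_ _∧_
    ·-identity : Identity _≡_ e _·_

  _≤_ : Carrier → Carrier → Set a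
  x ≤ y = x ∧ y ≡ x

  field
    resid-／ : ∀ x y z → (x · y ≤ z → x ≤ z ／ y) × (x ≤ z ／ y → x · y ≤ z)
    resid-＼ : ∀ x y z → (x · y ≤ z → y ≤ x ＼ z) × (y ≤ x ＼ z → x · y ≤ z)

module _ {a : Level} (A : UnitalResiduatedBinar a) where
  open UnitalResiduatedBinar A

  IsBounded : Carrier → Carrier → Set a
  IsBounded b t = (∀ x → b ≤ x) × (∀ x → x ≤ t)

  IsComplementOf : (b t e′ : Carrier) → Set a
  IsComplementOf b t e′ = (e ∧ e′ ≡ b) × (e ∨ e′ ≡ t)

  LeftMeetDistributive : Set a
  LeftMeetDistributive = ∀ x y z → x · (y ∧ z) ≡ x · y ∧ x · z

  RightMeetDistributive : Set a
  RightMeetDistributive = ∀ x y z → (x ∧ y) · z ≡ x · z ∧ y · z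

  LeftDivMeetToJoin : Set a
  LeftDivMeetToJoin = ∀ x y z → (x ∧ y) ＼ z ≡ (x ＼ z) ∨ (y ＼ z)

  RightDivMeetToJoin : Set a
  RightDivMeetToJoin = ∀ x y z → x ／ (y ∧ z) ≡ (x ／ y) ∨ (x ／ z)

  Integral : Set a
  Integral = ∀ x → x ≤ e

-- If ⊤ e′ = ⊥ or e′ ⊤ = ⊥, then e′ = ⊥ (as e′ = e e′ ≤ ⊤ e′ and e′ = e′ e ≤ e′ ⊤), so ⊤ = e ∨ e′ = e.
-- Left meet-distributivity gives ⊤ e′ = ⊤ e ∧ ⊤ e′ = ⊤ (e ∧ e′) = ⊤ ⊥ = ⊥, and the
-- left-division identity gives ⊤ = ⊥ \ ⊥ = (e ∧ e′) \ ⊥ = e \ ⊥ ∨ e′ \ ⊥ = e′ \ ⊥, i.e.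
-- e′ ⊤ = ⊥. The two right-handed identities are the left-handed ones in the opposite
-- binar, where multiplication is reversed and the divisions swap roles.
module Submission where

open import Defs
open import Level using (Level)
open import Data.Sum using (_⊎_; inj₁; inj₂)
open import Data.Product using (_,_; proj₁; proj₂)
open import Relation.Binary.Bundles using (Poset)
open import Relation.Binary.PropositionalEquality using (_≡_; refl; sym; trans; subst; cong; isEquivalence; module ≡-Reasoning)
open import Algebra.Lattice.Bundles using (Lattice)
open import Algebra.Lattice.Structures using (IsLattice)
import Algebra.Lattice.Properties.Lattice as LatticeProperties
import Relation.Binary.Reasoning.PartialOrder as ≤-Reasoning

opposite : {a : Level} → UnitalResiduatedBinar a → UnitalResiduatedBinar a
opposite A = record
  { Carrier    = Carrier
  ; _∨_        = _∨_
  ; _∧_        = _∧_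
  ; _·_        = λ x y → y · x
  ; _＼_       = λ x z → z ／ x
  ; _／_       = λ z y → y ＼ z
  ; e          = e
  ; isLattice  = isLattice
  ; ·-identity = proj₂ ·-identity , proj₁ ·-identity
  ; resid-／   = λ x y z → resid-＼ y x z
  ; resid-＼   = λ x y z → resid-／ y x z
  }
  where open UnitalResiduatedBinar A

module Order {a : Level} (A : UnitalResiduatedBinar a) where
  open UnitalResiduatedBinar A

  lattice : Lattice a a
  lattice = record { isLattice = isLattice }

  open LatticeProperties lattice using (poset; ∧-idem)
  open Poset poset using () renaming (trans to ⊑-trans; antisym to ⊑-antisym)

  ≤-refl : ∀ {x} → x ≤ x
  ≤-refl {x} = ∧-idem x

  ≤-trans : ∀ {x y z} → x ≤ y → y ≤ z → x ≤ z
  ≤-trans p q = sym (⊑-trans (sym p) (sym q))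

  ≤-antisym : ∀ {x y} → x ≤ y → y ≤ x → x ≡ y
  ≤-antisym p q = ⊑-antisym (sym p) (sym q)

  ≤-poset : Poset a a a
  ≤-poset = record
    { isPartialOrder = record
      { isPreorder = record
        { isEquivalence = isEquivalence
        ; reflexive     = λ { refl → ≤-refl }
        ; trans         = ≤-trans
        }
      ; antisym = ≤-antisym
      }
    }

  ·-monoˡ-≤ : ∀ {x y} z → x ≤ y → x · z ≤ y · z
  ·-monoˡ-≤ {x} {y} z x≤y =
    proj₂ (resid-／ x z (y · z)) (≤-trans x≤y (proj₁ (resid-／ y z (y · z)) ≤-refl))

  ·-monoʳ-≤ : ∀ {x y} z → x ≤ y → z · x ≤ z · y
  ·-monoʳ-≤ {x} {y} z x≤y =
    proj₂ (resid-＼ z x (z · y)) (≤-trans x≤y (proj₁ (resid-＼ z y (z · y)) ≤-refl))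

  ＼-identityˡ : ∀ x → e ＼ x ≡ x
  ＼-identityˡ x = ≤-antisym
    (subst (_≤ x) (proj₁ ·-identity (e ＼ x)) (proj₂ (resid-＼ e (e ＼ x) x) ≤-refl))
    (proj₁ (resid-＼ e x x) (subst (_≤ x) (sym (proj₁ ·-identity x)) ≤-refl))

module Bounded {a : Level} (A : UnitalResiduatedBinar a)
    (⊥ ⊤ : UnitalResiduatedBinar.Carrier A) (bounded : IsBounded A ⊥ ⊤) where
  open UnitalResiduatedBinar A
  open IsLattice isLattice using (∧-comm; ∨-comm; ∨-absorbs-∧)
  open Order A

  ⊥-minimum : ∀ x → ⊥ ≤ x
  ⊥-minimum = proj₁ bounded

  ⊤-maximum : ∀ x → x ≤ ⊤
  ⊤-maximum = proj₂ bounded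

  ∨-identityˡ : ∀ x → ⊥ ∨ x ≡ x
  ∨-identityˡ x = begin
    ⊥ ∨ x       ≡⟨ ∨-comm ⊥ x ⟩
    x ∨ ⊥       ≡⟨ cong (x ∨_) (sym (trans (∧-comm x ⊥) (⊥-minimum x))) ⟩
    x ∨ x ∧ ⊥   ≡⟨ ∨-absorbs-∧ x ⊥ ⟩
    x           ∎
    where open ≡-Reasoning

  ∧-identityˡ : ∀ x → ⊤ ∧ x ≡ x
  ∧-identityˡ x = trans (∧-comm ⊤ x) (⊤-maximum x)

  ·-zeroˡ : ∀ x → ⊥ · x ≡ ⊥
  ·-zeroˡ x = ≤-antisym (proj₂ (resid-／ ⊥ x ⊥) (⊥-minimum _)) (⊥-minimum _)

  ·-zeroʳ : ∀ x → x · ⊥ ≡ ⊥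
  ·-zeroʳ x = ≤-antisym (proj₂ (resid-＼ x ⊥ ⊥) (⊥-minimum _)) (⊥-minimum _)

  ⊥＼⊥≡⊤ : ⊥ ＼ ⊥ ≡ ⊤
  ⊥＼⊥≡⊤ = ≤-antisym (⊤-maximum _) (proj₁ (resid-＼ ⊥ ⊤ ⊥) (subst (_≤ ⊥) (sym (·-zeroˡ ⊤)) ≤-refl))

module Complemented {a : Level} (A : UnitalResiduatedBinar a)
    (⊥ ⊤ e′ : UnitalResiduatedBinar.Carrier A) (bounded : IsBounded A ⊥ ⊤)
    (complement : IsComplementOf A ⊥ ⊤ e′) where
  open UnitalResiduatedBinar A
  open IsLattice isLattice using (∨-comm)
  open Order A
  open Bounded A ⊥ ⊤ bounded
  open ≤-Reasoning ≤-poset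

  complement≤⊥⇒integral : e′ ≤ ⊥ → Integral A
  complement≤⊥⇒integral e′≤⊥ x = subst (x ≤_) ⊤≡e (⊤-maximum x)
    where
      ⊤≡e : ⊤ ≡ e
      ⊤≡e = begin-equality
        ⊤       ≡⟨ sym (proj₂ complement) ⟩
        e ∨ e′  ≡⟨ cong (e ∨_) (≤-antisym e′≤⊥ (⊥-minimum e′)) ⟩
        e ∨ ⊥   ≡⟨ ∨-comm e ⊥ ⟩
        ⊥ ∨ e   ≡⟨ ∨-identityˡ e ⟩
        e       ∎

  leftMeetDistributive⇒integral : LeftMeetDistributive A → Integral A
  leftMeetDistributive⇒integral distrib = complement≤⊥⇒integral (begin
    e′      ≡⟨ sym (proj₁ ·-identity e′) ⟩
    e · e′  ≤⟨ ·-monoˡ-≤ e′ (⊤-maximum e) ⟩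
    ⊤ · e′  ≡⟨ ⊤·e′≡⊥ ⟩
    ⊥       ∎)
    where
      ⊤·e′≡⊥ : ⊤ · e′ ≡ ⊥
      ⊤·e′≡⊥ = begin-equality
        ⊤ · e′           ≡⟨ sym (∧-identityˡ (⊤ · e′)) ⟩
        ⊤ ∧ ⊤ · e′       ≡⟨ cong (_∧ ⊤ · e′) (sym (proj₂ ·-identity ⊤)) ⟩
        ⊤ · e ∧ ⊤ · e′   ≡⟨ sym (distrib ⊤ e e′) ⟩
        ⊤ · (e ∧ e′)     ≡⟨ cong (⊤ ·_) (proj₁ complement) ⟩
        ⊤ · ⊥            ≡⟨ ·-zeroʳ ⊤ ⟩
        ⊥                ∎

  leftDivMeetToJoin⇒integral : LeftDivMeetToJoin A → Integral A
  leftDivMeetToJoin⇒integral distrib = complement≤⊥⇒integral (begin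
    e′      ≡⟨ sym (proj₂ ·-identity e′) ⟩
    e′ · e  ≤⟨ ·-monoʳ-≤ e′ (⊤-maximum e) ⟩
    e′ · ⊤  ≤⟨ proj₂ (resid-＼ e′ ⊤ ⊥) (subst (_≤ e′ ＼ ⊥) (sym ⊤≡e′＼⊥) ≤-refl) ⟩
    ⊥       ∎)
    where
      ⊤≡e′＼⊥ : ⊤ ≡ e′ ＼ ⊥
      ⊤≡e′＼⊥ = begin-equality
        ⊤                  ≡⟨ sym ⊥＼⊥≡⊤ ⟩
        ⊥ ＼ ⊥             ≡⟨ cong (_＼ ⊥) (sym (proj₁ complement)) ⟩
        (e ∧ e′) ＼ ⊥      ≡⟨ distrib e e′ ⊥ ⟩
        e ＼ ⊥ ∨ e′ ＼ ⊥   ≡⟨ cong (_∨ e′ ＼ ⊥) (＼-identityˡ ⊥) ⟩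
        ⊥ ∨ e′ ＼ ⊥        ≡⟨ ∨-identityˡ (e′ ＼ ⊥) ⟩
        e′ ＼ ⊥            ∎

lemma4p2 : {a : Level} (A : UnitalResiduatedBinar a)
    → (b t e′ : UnitalResiduatedBinar.Carrier A)
    → IsBounded A b t
    → IsComplementOf A b t e′
    → LeftMeetDistributive A ⊎ RightMeetDistributive A ⊎ LeftDivMeetToJoin A ⊎ RightDivMeetToJoin A
    → Integral A
lemma4p2 A b t e′ bounded complement (inj₁ distrib) =
  Complemented.leftMeetDistributive⇒integral A b t e′ bounded complement distrib
lemma4p2 A b t e′ bounded complement (inj₂ (inj₁ distrib)) =
  Complemented.leftMeetDistributive⇒integral (opposite A) b t e′ bounded complement
    (λ x y z → distrib y z x)
lemma4p2 A b t e′ bounded complement (inj₂ (inj₂ (inj₁ distrib))) =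
  Complemented.leftDivMeetToJoin⇒integral A b t e′ bounded complement distrib
lemma4p2 A b t e′ bounded complement (inj₂ (inj₂ (inj₂ distrib))) =
  Complemented.leftDivMeetToJoin⇒integral (opposite A) b t e′ bounded complement
    (λ x y z → distrib z x y)
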